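{- Let $\mathcal{H}$ be any hypergraph on vertex set $V(\mathcal{H})=\{v_1,\ldots,v_n\}$ and let $d$ be an integer with $2\le d\le n$. Let $\mathcal{F}$ be a family of $(d+1)$-sized subsets of $V(\mathcal{H})$ such that for every $B \in E(\mathcal{H})$ there exists $A \in \mathcal{F}$ with (i) $|B \cap A|\geq 2$, when $d$ is even; (ii) $2 \leq |B \cap A| \leq d$, when $d$ is odd. Then there exists an induced-bisecting family of order $d$ for $\mathcal{H}$ of cardinality $|\mathcal{F}|(d+1)$.
   Context: For $S\subseteq V(\mathcal{H})$, a bicoloring of $S$ is a map $X^S:S\to\{+1,-1\}$; write $X^S(+1)$ and $X^S(-1)$ for the sets of vertices of $S$ colored $+1$ and $-1$. A hyperedge $A$ is induced-bisected by $X^S$ if $|A\cap X^S(+1)|=|A\cap X^S(-1)|\neq 0$. The trivial hyperedges (subsets) are the empty set and the singletons, together with the whole vertex set $V(\mathcal{H})$ when $d$ is odd. A set $\{X^{S_1},\ldots,X^{S_t}\}$ of bicolorings is an induced-bisecting family of order $d$ for $\mathcal{H}$ if each $S_i$ has exactly $d$ vertices and every non-trivial hyperedge of $\mathcal{H}$ is induced-bisected by at least one $X^{S_i}$. -}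

module Defs where

open import Data.Nat using (ℕ; zero; suc; _≤_; _%_; _+_)
open import Data.Bool using (Bool)
open import Data.Maybe using (Maybe; just; nothing)
open import Data.Sign using (Sign; +; -)
open import Data.Vec using (Vec; map)
open import Data.Fin.Subset using (Subset; _∩_; ∣_∣; ⊤; inside; outside)
open import Data.List using (List)
open import Data.List.Membership.Propositional using (_∈_)
open import Data.List.Relation.Unary.All using (All)
open import Data.List.Relation.Unary.Any using (Any)
open import Data.Product using (_×_; Σ)
open import Data.Sum using (_⊎_)
open import Relation.Binary.PropositionalEquality using (_≡_; _≢_)
open import Relation.Nullary using (¬_)

-- Vertex set V(H) = {v_1,...,v_n} is modelled as Fin n; a subset of V(H)
-- is a Subset n (characteristic vector).

record Hypergraph (n : ℕ) : Set where
  constructor hypergraph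
  field
    edges : List (Subset n)
open Hypergraph public

Odd Even : ℕ → Set
Even d = d % 2 ≡ 0
Odd d = d % 2 ≡ 1

-- A bicoloring X^S of a set S ⊆ V(H): entry i is nothing if v_i ∉ S,
-- and just s (s ∈ {+,-}) giving the colour X^S(v_i) if v_i ∈ S.
Bicoloring : ℕ → Set
Bicoloring n = Vec (Maybe Sign) n

private
  isDom isPlus isMinus : Maybe Sign → Bool
  isDom nothing = outside
  isDom (just _) = inside
  isPlus (just +) = inside
  isPlus _ = outside
  isMinus (just -) = inside
  isMinus _ = outside

domain : ∀ {n} → Bicoloring n → Subset n
domain = map isDom

plusSet minusSet : ∀ {n} → Bicoloring n → Subset n
plusSet = map isPlus
minusSet = map isMinus

InducedBisects : ∀ {n} → Bicoloring n → Subset n → Set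
InducedBisects X A =
  (∣ A ∩ plusSet X ∣ ≡ ∣ A ∩ minusSet X ∣) × (∣ A ∩ plusSet X ∣ ≢ 0)

Trivial : ∀ {n} → ℕ → Subset n → Set
Trivial d A = (∣ A ∣ ≤ 1) ⊎ (Odd d × A ≡ ⊤)

-- An induced-bisecting family of order d for H, given as a list of
-- bicolorings (its cardinality is the length of the list).
IsInducedBisectingFamily : ∀ {n} → ℕ → Hypergraph n → List (Bicoloring n) → Set
IsInducedBisectingFamily d H fam =
  All (λ X → ∣ domain X ∣ ≡ d) fam ×
  (∀ A → A ∈ edges H → ¬ Trivial d A → Any (λ X → InducedBisects X A) fam)

Covers : ∀ {n} → ℕ → Subset n → Subset n → Set
Covers d B A =
  (Even d → 2 ≤ ∣ B ∩ A ∣) × (Odd d → (2 ≤ ∣ B ∩ A ∣) × (∣ B ∩ A ∣ ≤ d))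

-- Number the d + 1 members of A cyclically.  Colouring j leaves j out, colours the h = ⌊d/2⌋ members
-- after j with + and the remaining d − h with −.  With k = |A ∩ B| and N j, M j the numbers of members
-- of B coloured + and −, colouring j bisects B iff v j = 2 N j + [j ∈ B] equals k, and then N j ≥ 1
-- because k ≥ 2.  Moving from j to j + 1 changes v by at most 2, and jumping over k upwards forces k to
-- be odd while jumping over it downwards forces k to be even; as v is periodic it cannot jump over k
-- both ways, so it meets k once it takes values ≤ k and ≥ k.  Those come from summing v over the
-- antipodal pair j, j + h for even d (using some j ∈ B, i.e. k ≥ 1) and j, j + h + 1 for odd d
-- (using some j ∉ B, i.e. k ≤ d): the sum is 2k up to a correction of at most one.

module Submission where

open import Defs
open import Data.Bool using (Bool; true; false; _∧_; if_then_else_)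
open import Data.Bool.Properties using (∧-identityʳ; ∧-zeroʳ)
open import Data.Empty using (⊥; ⊥-elim)
open import Data.Fin.Subset using (Subset; _∩_; ∣_∣)
open import Data.List as List using (List; []; _∷_; length; upTo; concatMap)
open import Data.List.Properties using (length-map; length-upTo; length-++)
open import Data.List.Membership.Propositional using (_∈_; lose)
open import Data.List.Membership.Propositional.Properties using (∈-map⁺; ∈-upTo⁺)
open import Data.List.Relation.Unary.All as All using (All)
import Data.List.Relation.Unary.All.Properties as All
open import Data.List.Relation.Unary.Any using (Any)
import Data.List.Relation.Unary.Any.Properties as Any
open import Data.List.Relation.Unary.Unique.Propositional using (Unique)
open import Data.Maybe using (Maybe; just; nothing)
open import Data.Nat using (ℕ; zero; suc; _+_; _*_; _∸_; _%_; _/_; _≤_; _<_; _<?_; z≤n; s≤s; z<s; NonZero)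
open import Data.Nat.DivMod using (m≡m%n+[m/n]*n; m/n≤m; m%n<n; m<n⇒m%n≡m; [m+n]%n≡m%n; [m+kn]%n≡m%n)
open import Data.Nat.Properties
open import Data.Nat.Tactic.RingSolver using (solve-∀)
open import Data.Product using (Σ; ∃; _×_; _,_; proj₁; proj₂)
open import Data.Sign using (Sign) renaming (+ to +ˢ; - to -ˢ)
open import Data.Sum using (_⊎_; inj₁; inj₂; [_,_]′)
open import Data.Vec using ([]; _∷_; map)
open import Data.Vec.Properties using (map-cong)
open import Function using (_∘_)
open import Relation.Nullary using (¬_; does; yes; no)
open import Relation.Nullary.Decidable using (dec-true; dec-false)
open import Relation.Binary.PropositionalEquality
  using (_≡_; _≢_; refl; sym; trans; cong; cong₂; subst; subst₂; module ≡-Reasoning)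

⟦_⟧ : Bool → ℕ
⟦ true ⟧ = 1
⟦ false ⟧ = 0

⟦⟧≤1 : ∀ b → ⟦ b ⟧ ≤ 1
⟦⟧≤1 true = s≤s z≤n
⟦⟧≤1 false = z≤n

∑ : (ℕ → ℕ) → ℕ → ℕ → ℕ
∑ f c zero = 0
∑ f c (suc n) = f c + ∑ f (suc c) n

∑-++ : ∀ f c p q → ∑ f c (p + q) ≡ ∑ f c p + ∑ f (c + p) q
∑-++ f c zero q = cong (λ c′ → ∑ f c′ q) (sym (+-identityʳ c))
∑-++ f c (suc p) q = begin
  f c + ∑ f (suc c) (p + q)                ≡⟨ cong (f c +_) (∑-++ f (suc c) p q) ⟩
  f c + (∑ f (suc c) p + ∑ f (suc c + p) q) ≡⟨ sym (+-assoc (f c) _ _) ⟩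
  ∑ f c (suc p) + ∑ f (suc c + p) q          ≡⟨ cong (λ c′ → ∑ f c (suc p) + ∑ f c′ q) (sym (+-suc c p)) ⟩
  ∑ f c (suc p) + ∑ f (c + suc p) q          ∎
  where open ≡-Reasoning

∑-cong : ∀ {f g} c n → (∀ {i} → c ≤ i → i < c + n → f i ≡ g i) → ∑ f c n ≡ ∑ g c n
∑-cong c zero f≗g = refl
∑-cong c (suc n) f≗g =
  cong₂ _+_ (f≗g ≤-refl (m<m+n c z<s))
            (∑-cong (suc c) n λ {i} c<i i<c+n → f≗g (<⇒≤ c<i) (subst (i <_) (sym (+-suc c n)) i<c+n))

∑-const : ∀ a c n → ∑ (λ _ → a) c n ≡ n * a
∑-const a c zero = refl
∑-const a c (suc n) = cong (a +_) (∑-const a (suc c) n)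

∑-shift : ∀ f a c n → ∑ f (a + c) n ≡ ∑ (λ i → f (a + i)) c n
∑-shift f a c zero = refl
∑-shift f a c (suc n) =
  cong (f (a + c) +_) (trans (cong (λ c′ → ∑ f c′ n) (sym (+-suc a c))) (∑-shift f a (suc c) n))

∑-shift-suc : ∀ f a c n → ∑ (λ i → f (a + suc i)) c n ≡ ∑ f (suc a + c) n
∑-shift-suc f a c n = sym (trans (∑-shift f (suc a) c n) (∑-cong c n (λ {i} _ _ → cong f (sym (+-suc a i)))))

∑-from-0 : ∀ f n → ∑ f 0 (suc n) ≡ f 0 + ∑ (f ∘ suc) 0 n
∑-from-0 f n = cong (f 0 +_) (∑-shift f 1 0 n)

∑-∧-true : ∀ (y : ℕ → Bool) c n → ∑ (λ i → ⟦ y i ∧ true ⟧) c n ≡ ∑ (λ i → ⟦ y i ⟧) c n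
∑-∧-true y c n = ∑-cong {λ i → ⟦ y i ∧ true ⟧} c n (λ {i} _ _ → cong ⟦_⟧ (∧-identityʳ (y i)))

∑-∧-false : ∀ (y : ℕ → Bool) c n → ∑ (λ i → ⟦ y i ∧ false ⟧) c n ≡ 0
∑-∧-false y c n = trans (∑-cong {λ i → ⟦ y i ∧ false ⟧} c n (λ {i} _ _ → cong ⟦_⟧ (∧-zeroʳ (y i)))) (trans (∑-const 0 c n) (*-zeroʳ n))

∑-if : ∀ f g h r → ∑ (λ t → if does (t <? h) then f t else g t) 0 (h + r) ≡ ∑ f 0 h + ∑ g h r
∑-if f g h r = trans (∑-++ _ 0 h r) (cong₂ _+_ (∑-cong 0 h below) (∑-cong h r above))
  where
  below : ∀ {t} → 0 ≤ t → t < 0 + h → (if does (t <? h) then f t else g t) ≡ f t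
  below {t} _ t<h = cong (if_then f t else g t) (dec-true (t <? h) t<h)
  above : ∀ {t} → h ≤ t → t < h + r → (if does (t <? h) then f t else g t) ≡ g t
  above {t} h≤t _ = cong (if_then f t else g t) (dec-false (t <? h) (≤⇒≯ h≤t))

∑-pos : ∀ (g : ℕ → Bool) c n → 0 < ∑ (λ i → ⟦ g i ⟧) c n → ∃ λ i → g i ≡ true
∑-pos g c (suc n) pos with g c in eq
... | true = c , eq
... | false = ∑-pos g (suc c) n pos

∑-<-length : ∀ (g : ℕ → Bool) c n → ∑ (λ i → ⟦ g i ⟧) c n < n → ∃ λ i → g i ≡ false
∑-<-length g c (suc n) lt with g c in eq
... | true = ∑-<-length g (suc c) n (≤-pred lt)
... | false = c , eq

Periodic : {A : Set} → ℕ → (ℕ → A) → Set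
Periodic m f = ∀ i → f (m + i) ≡ f i

∑-rotate : ∀ {m} {f : ℕ → ℕ} → Periodic m f → ∀ c → ∑ f c m ≡ ∑ f 0 m
∑-rotate p zero = refl
∑-rotate {m} {f} p (suc c) = trans drop-first (∑-rotate p c)
  where
  open ≡-Reasoning
  drop-first : ∑ f (suc c) m ≡ ∑ f c m
  drop-first = +-cancelˡ-≡ (f c) _ _ (begin
    f c + ∑ f (suc c) m        ≡⟨ cong (∑ f c) (+-comm 1 m) ⟩
    ∑ f c (m + 1)              ≡⟨ ∑-++ f c m 1 ⟩
    ∑ f c m + (f (c + m) + 0)  ≡⟨ cong (λ i → ∑ f c m + i) (trans (+-identityʳ _) (trans (cong f (+-comm c m)) (p c))) ⟩
    ∑ f c m + f c              ≡⟨ +-comm (∑ f c m) (f c) ⟩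
    f c + ∑ f c m              ∎)

periodic-* : ∀ {A : Set} {m} {f : ℕ → A} → Periodic m f → ∀ t r → f (t * m + r) ≡ f r
periodic-* p zero r = refl
periodic-* {m = m} {f} p (suc t) r = trans (cong f (+-assoc m (t * m) r)) (trans (p _) (periodic-* p t r))

periodic-% : ∀ {A : Set} {m} {f : ℕ → A} .{{_ : NonZero m}} → Periodic m f → ∀ j → f (j % m) ≡ f j
periodic-% {m = m} {f = f} p j = begin
  f (j % m)                 ≡⟨ periodic-* p (j / m) (j % m) ⟨
  f (j / m * m + j % m)     ≡⟨ cong f (+-comm (j / m * m) (j % m)) ⟩
  f (j % m + j / m * m)     ≡⟨ cong f (m≡m%n+[m/n]*n j m) ⟨
  f j                       ∎
  where open ≡-Reasoning

periodic-recurs : ∀ {A : Set} {m} {f : ℕ → A} .{{_ : NonZero m}} → Periodic m f → ∀ a b → ∃ λ n → f (a + n) ≡ f b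
periodic-recurs {m = m} {f = f} p a b with m≤n⇒∃[o]m+o≡n (≤-trans (m≤m*n a m) (m≤m+n (a * m) b))
... | n , a+n≡a*m+b = n , trans (cong f a+n≡a*m+b) (periodic-* p a b)

UpCrossing DownCrossing : (ℕ → ℕ) → ℕ → ℕ → Set
UpCrossing v k i = v i < k × k < v (suc i)
DownCrossing v k i = k < v i × v (suc i) < k

module _ (v : ℕ → ℕ) (k : ℕ) where

  walk-up : ∀ a n → v a ≤ k → k ≤ v (a + n) → (∃ λ i → v i ≡ k) ⊎ (∃ λ i → UpCrossing v k i)
  walk-up a zero va≤k k≤va = inj₁ (a , ≤-antisym va≤k (subst (λ i → k ≤ v i) (+-identityʳ a) k≤va))
  walk-up a (suc n) va≤k k≤vb with v a ≟ k | v (suc a) ≤? k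
  ... | yes va≡k | _ = inj₁ (a , va≡k)
  ... | no va≢k | yes va′≤k = walk-up (suc a) n va′≤k (subst (λ i → k ≤ v i) (+-suc a n) k≤vb)
  ... | no va≢k | no va′≰k = inj₂ (a , ≤∧≢⇒< va≤k va≢k , ≰⇒> va′≰k)

  walk-down : ∀ a n → k ≤ v a → v (a + n) ≤ k → (∃ λ i → v i ≡ k) ⊎ (∃ λ i → DownCrossing v k i)
  walk-down a zero k≤va va≤k = inj₁ (a , ≤-antisym (subst (λ i → v i ≤ k) (+-identityʳ a) va≤k) k≤va)
  walk-down a (suc n) k≤va vb≤k with v a ≟ k | k ≤? v (suc a)
  ... | yes va≡k | _ = inj₁ (a , va≡k)
  ... | no va≢k | yes k≤va′ = walk-down (suc a) n k≤va′ (subst (λ i → v i ≤ k) (+-suc a n) vb≤k)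
  ... | no va≢k | no k≰va′ = inj₂ (a , ≤∧≢⇒< k≤va (va≢k ∘ sym) , ≰⇒> k≰va′)

periodic-hits : ∀ {m v k a b} .{{_ : NonZero m}} → Periodic m v → v a ≤ k → k ≤ v b →
                (∀ {i i′} → UpCrossing v k i → DownCrossing v k i′ → ⊥) → ∃ λ j → v j ≡ k
periodic-hits {m} {v} {k} {a} {b} p va≤k k≤vb no-double-jump
  with periodic-recurs p a b
... | n , vn≡vb with walk-up v k a n va≤k (subst (k ≤_) (sym vn≡vb) k≤vb)
...   | inj₁ hit = hit
...   | inj₂ (_ , up) with periodic-recurs p (a + n) a
...     | n′ , vn′≡va with walk-down v k (a + n) n′ (subst (k ≤_) (sym vn≡vb) k≤vb) (subst (_≤ k) (sym vn′≡va) va≤k)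
...       | inj₁ hit = hit
...       | inj₂ (_ , down) = ⊥-elim (no-double-jump up down)

squeeze : ∀ {c a k b} → c ≤ a → a < k → k < b → b ≤ 2 + c → k ≡ suc c
squeeze c≤a a<k k<b b≤2+c = ≤-antisym (≤-pred (≤-trans k<b b≤2+c)) (≤-<-trans c≤a a<k)

2*-≡-+ : ∀ k → 2 * k ≡ k + k
2*-≡-+ k = cong (k +_) (+-identityʳ k)

one-≤ : ∀ {a b k} → a + b ≤ 2 * k → a ≤ k ⊎ b ≤ k
one-≤ {a} {b} {k} a+b≤2k with a ≤? k | b ≤? k
... | yes a≤k | _ = inj₁ a≤k
... | no _ | yes b≤k = inj₂ b≤k
... | no a≰k | no b≰k =
  ⊥-elim (<⇒≱ (subst (_< a + b) (sym (2*-≡-+ k)) (+-mono-< (≰⇒> a≰k) (≰⇒> b≰k))) a+b≤2k)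

one-≥ : ∀ {a b k} → 2 * k ≤ suc (a + b) → k ≤ a ⊎ k ≤ b
one-≥ {a} {b} {k} 2k≤1+a+b with k ≤? a | k ≤? b
... | yes k≤a | _ = inj₁ k≤a
... | no _ | yes k≤b = inj₂ k≤b
... | no k≰a | no k≰b =
  ⊥-elim (<⇒≱ (subst₂ _≤_ (cong suc (+-suc a b)) (sym (2*-≡-+ k)) (+-mono-≤ (≰⇒> k≰a) (≰⇒> k≰b))) 2k≤1+a+b)

≤-by-+ : ∀ {s a K b} → s + a ≡ K + b → b ≤ a → s ≤ K
≤-by-+ {s} {a} {K} {b} eq b≤a = +-cancelʳ-≤ a s K (subst (_≤ K + a) (sym eq) (+-monoʳ-≤ K b≤a))

≥-by-+ : ∀ {s a K b} → s + a ≡ K + b → a ≤ b → K ≤ s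
≥-by-+ {s} {a} {K} {b} eq a≤b = +-cancelʳ-≤ b K s (subst (_≤ s + b) eq (+-monoʳ-≤ s a≤b))

is+ is- is-coloured : Maybe Sign → Bool
is+ (just +ˢ) = true
is+ _ = false
is- (just -ˢ) = true
is- _ = false
is-coloured (just _) = true
is-coloured nothing = false

-- Colouring j of the cycle 0, 1, …, d leaves j uncoloured, colours the h positions after j with +
-- and the remaining d ∸ h positions with −; (r + d * j) % m is the distance from j to r along the cycle of length m.
module Rotation (d h : ℕ) where

  m : ℕ
  m = suc d

  signAt : ℕ → Sign
  signAt t = if does (t <? h) then +ˢ else -ˢ

  colourAt : ℕ → Maybe Sign
  colourAt zero = nothing
  colourAt (suc t) = just (signAt t)

  colour : ℕ → ℕ → Maybe Sign
  colour j r = colourAt ((r + d * j) % m)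

  count : (Maybe Sign → Bool) → (ℕ → Bool) → ℕ → ℕ
  count P y j = ∑ (λ r → ⟦ y r ∧ P (colour j r) ⟧) 0 m

  distance-periodic : ∀ j → Periodic m (λ r → (r + d * j) % m)
  distance-periodic j r = trans (cong (_% m) (trans (+-assoc m r (d * j)) (+-comm m _))) ([m+n]%n≡m%n (r + d * j) m)

  distance-from : ∀ j t → t < m → (j + t + d * j) % m ≡ t
  distance-from j t t<m = trans (cong (_% m) (rearrange j t d)) (trans ([m+kn]%n≡m%n t j m) (m<n⇒m%n≡m t<m))
    where
    rearrange : ∀ j t d → j + t + d * j ≡ t + j * suc d
    rearrange = solve-∀

  count-by-distance : ∀ P y → Periodic m y → ∀ j → count P y j ≡ ∑ (λ t → ⟦ y (j + t) ∧ P (colourAt t) ⟧) 0 m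
  count-by-distance P y y-periodic j = begin
    ∑ f 0 m                   ≡⟨ ∑-rotate f-periodic j ⟨
    ∑ f j m                   ≡⟨ cong (λ c → ∑ f c m) (+-identityʳ j) ⟨
    ∑ f (j + 0) m             ≡⟨ ∑-shift f j 0 m ⟩
    ∑ (λ t → f (j + t)) 0 m   ≡⟨ ∑-cong 0 m (λ {t} _ t<m → cong (λ c → ⟦ y (j + t) ∧ P (colourAt c) ⟧) (distance-from j t t<m)) ⟩
    ∑ (λ t → ⟦ y (j + t) ∧ P (colourAt t) ⟧) 0 m ∎
    where
    open ≡-Reasoning
    f : ℕ → ℕ
    f r = ⟦ y r ∧ P (colour j r) ⟧
    f-periodic : Periodic m f
    f-periodic r = cong₂ (λ b c → ⟦ b ∧ P (colourAt c) ⟧) (y-periodic r) (distance-periodic j r)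

  count-windows : ∀ P y → P nothing ≡ false → Periodic m y → h ≤ d → ∀ j →
    count P y j ≡ ∑ (λ i → ⟦ y i ∧ P (just +ˢ) ⟧) (suc j) h + ∑ (λ i → ⟦ y i ∧ P (just -ˢ) ⟧) (suc j + h) (d ∸ h)
  count-windows P y P-nothing y-periodic h≤d j = begin
    count P y j                                      ≡⟨ count-by-distance P y y-periodic j ⟩
    ⟦ y (j + 0) ∧ P nothing ⟧ + ∑ g 1 d              ≡⟨ cong (λ b → ⟦ y (j + 0) ∧ b ⟧ + ∑ g 1 d) P-nothing ⟩
    ⟦ y (j + 0) ∧ false ⟧ + ∑ g 1 d                  ≡⟨ cong (λ b → ⟦ b ⟧ + ∑ g 1 d) (∧-zeroʳ (y (j + 0))) ⟩
    ∑ g 1 d                                          ≡⟨ ∑-shift g 1 0 d ⟩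
    ∑ (λ t → g (suc t)) 0 d                          ≡⟨ ∑-cong 0 d (λ {t} _ _ → sign-split t) ⟩
    ∑ (λ t → if does (t <? h) then G+ t else G- t) 0 d
                                                     ≡⟨ cong (∑ _ 0) (m+[n∸m]≡n h≤d) ⟨
    ∑ (λ t → if does (t <? h) then G+ t else G- t) 0 (h + (d ∸ h))
                                                     ≡⟨ ∑-if G+ G- h (d ∸ h) ⟩
    ∑ G+ 0 h + ∑ G- h (d ∸ h)                        ≡⟨ cong₂ _+_ (trans (∑-shift-suc F+ j 0 h) (cong (λ c → ∑ F+ c h) (+-identityʳ (suc j))))
                                                                  (∑-shift-suc F- j h (d ∸ h)) ⟩
    ∑ F+ (suc j) h + ∑ F- (suc j + h) (d ∸ h)        ∎
    where
    open ≡-Reasoning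
    g F+ F- G+ G- : ℕ → ℕ
    g t = ⟦ y (j + t) ∧ P (colourAt t) ⟧
    F+ i = ⟦ y i ∧ P (just +ˢ) ⟧
    F- i = ⟦ y i ∧ P (just -ˢ) ⟧
    G+ t = F+ (j + suc t)
    G- t = F- (j + suc t)
    sign-split : ∀ t → g (suc t) ≡ (if does (t <? h) then G+ t else G- t)
    sign-split t with does (t <? h)
    ... | true = refl
    ... | false = refl

  coloured-count : h ≤ d → ∀ j → count is-coloured (λ _ → true) j ≡ d
  coloured-count h≤d j = begin
    count is-coloured (λ _ → true) j  ≡⟨ count-windows is-coloured (λ _ → true) refl (λ _ → refl) h≤d j ⟩
    ∑ (λ _ → 1) (suc j) h + ∑ (λ _ → 1) (suc j + h) (d ∸ h)
                                      ≡⟨ cong₂ _+_ (∑-const 1 (suc j) h) (∑-const 1 (suc j + h) (d ∸ h)) ⟩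
    h * 1 + (d ∸ h) * 1               ≡⟨ cong₂ _+_ (*-identityʳ h) (*-identityʳ (d ∸ h)) ⟩
    h + (d ∸ h)                       ≡⟨ m+[n∸m]≡n h≤d ⟩
    d                                 ∎
    where open ≡-Reasoning

module Windows (d h : ℕ) (T : ℕ → Bool) where

  open Rotation d h public

  x : ℕ → Bool
  x i = T (i % m)

  X : ℕ → ℕ
  X i = ⟦ x i ⟧

  k : ℕ
  k = ∑ X 0 m

  N M v : ℕ → ℕ
  N j = ∑ X (suc j) h
  M j = ∑ X (suc j + h) (d ∸ h)
  v j = 2 * N j + X j

  x-periodic : Periodic m x
  x-periodic i = cong T (trans (cong (_% m) (+-comm m i)) ([m+n]%n≡m%n i m))

  X-periodic : Periodic m X
  X-periodic i = cong ⟦_⟧ (x-periodic i)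

  N-periodic : Periodic m N
  N-periodic j = begin
    ∑ X (suc (m + j)) h           ≡⟨ cong (λ c → ∑ X c h) (+-suc m j) ⟨
    ∑ X (m + suc j) h             ≡⟨ ∑-shift X m (suc j) h ⟩
    ∑ (λ i → X (m + i)) (suc j) h ≡⟨ ∑-cong (suc j) h (λ _ _ → X-periodic _) ⟩
    ∑ X (suc j) h                 ∎
    where open ≡-Reasoning

  v-periodic : Periodic m v
  v-periodic j = cong₂ (λ n b → 2 * n + b) (N-periodic j) (X-periodic j)

  around : h ≤ d → ∀ j → X j + N j + M j ≡ k
  around h≤d j = begin
    X j + N j + M j                       ≡⟨ +-assoc (X j) (N j) (M j) ⟩
    X j + (N j + M j)                     ≡⟨ cong (X j +_) (∑-++ X (suc j) h (d ∸ h)) ⟨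
    X j + ∑ X (suc j) (h + (d ∸ h))       ≡⟨ cong (λ n → X j + ∑ X (suc j) n) (m+[n∸m]≡n h≤d) ⟩
    ∑ X j m                               ≡⟨ ∑-rotate X-periodic j ⟩
    k                                     ∎
    where open ≡-Reasoning

  slide : ∀ j → N (suc j) + X (suc j) ≡ N j + X (suc j + h)
  slide j = begin
    N (suc j) + X (suc j)               ≡⟨ +-comm (N (suc j)) (X (suc j)) ⟩
    ∑ X (suc j) (suc h)                 ≡⟨ cong (∑ X (suc j)) (+-comm 1 h) ⟩
    ∑ X (suc j) (h + 1)                 ≡⟨ ∑-++ X (suc j) h 1 ⟩
    N j + (X (suc j + h) + 0)           ≡⟨ cong (N j +_) (+-identityʳ _) ⟩
    N j + X (suc j + h)                 ∎
    where open ≡-Reasoning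

  next-≤ : ∀ i → v (suc i) ≤ 2 + 2 * N i
  next-≤ i = begin
    2 * N (suc i) + X (suc i)           ≤⟨ +-monoʳ-≤ (2 * N (suc i)) (m≤m+n (X (suc i)) _) ⟩
    2 * N (suc i) + 2 * X (suc i)       ≡⟨ *-distribˡ-+ 2 (N (suc i)) (X (suc i)) ⟨
    2 * (N (suc i) + X (suc i))         ≡⟨ cong (2 *_) (slide i) ⟩
    2 * (N i + X (suc i + h))           ≤⟨ *-monoʳ-≤ 2 (+-monoʳ-≤ (N i) (⟦⟧≤1 (x (suc i + h)))) ⟩
    2 * (N i + 1)                       ≡⟨ *-distribˡ-+ 2 (N i) 1 ⟩
    2 * N i + 2                         ≡⟨ +-comm (2 * N i) 2 ⟩
    2 + 2 * N i                         ∎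
    where open ≤-Reasoning

  next-≥ : ∀ i → 2 * N i ≤ suc (v (suc i))
  next-≥ i = begin
    2 * N i                             ≤⟨ *-monoʳ-≤ 2 (m≤m+n (N i) (X (suc i + h))) ⟩
    2 * (N i + X (suc i + h))           ≡⟨ cong (2 *_) (slide i) ⟨
    2 * (N (suc i) + X (suc i))         ≡⟨ *-distribˡ-+ 2 (N (suc i)) (X (suc i)) ⟩
    2 * N (suc i) + (X (suc i) + (X (suc i) + 0))
                                        ≤⟨ +-monoʳ-≤ (2 * N (suc i)) (+-monoʳ-≤ (X (suc i)) (≤-trans (≤-reflexive (+-identityʳ _)) (⟦⟧≤1 (x (suc i))))) ⟩
    2 * N (suc i) + (X (suc i) + 1)     ≡⟨ +-assoc (2 * N (suc i)) (X (suc i)) 1 ⟨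
    v (suc i) + 1                       ≡⟨ +-comm (v (suc i)) 1 ⟩
    suc (v (suc i))                     ∎
    where open ≤-Reasoning

  up-crossing-odd : ∀ {i} → UpCrossing v k i → k ≡ suc (2 * N i)
  up-crossing-odd {i} (vi<k , k<vi′) = squeeze (m≤m+n (2 * N i) (X i)) vi<k k<vi′ (next-≤ i)

  down-crossing-even : ∀ {i} → DownCrossing v k i → k ≡ 2 * N i
  down-crossing-even {i} (k<vi , vi′<k) = suc-injective (squeeze (next-≥ i) (s≤s vi′<k) (s≤s k<vi) (s≤s vi≤1+2N))
    where
    vi≤1+2N : v i ≤ suc (2 * N i)
    vi≤1+2N = subst (v i ≤_) (+-comm (2 * N i) 1) (+-monoʳ-≤ (2 * N i) (⟦⟧≤1 (x i)))

  no-double-jump : ∀ {i i′} → UpCrossing v k i → DownCrossing v k i′ → ⊥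
  no-double-jump {i} {i′} up down = even≢odd (N i′) (N i) (trans (sym (down-crossing-even down)) (up-crossing-odd up))

  some-≤ : ∀ {i j} → v i + v j ≤ 2 * k → ∃ λ t → v t ≤ k
  some-≤ {i} {j} le = [ (i ,_) , (j ,_) ]′ (one-≤ le)

  some-≥ : ∀ {i j} → 2 * k ≤ suc (v i + v j) → ∃ λ t → k ≤ v t
  some-≥ {i} {j} ge = [ (i ,_) , (j ,_) ]′ (one-≥ ge)

  even-pair : d ≡ h + h → ∀ j → v j + v (j + h) + X j ≡ 2 * k + X (j + h)
  even-pair d≡2h j = begin
    v j + v (j + h) + X j                    ≡⟨ rearrange (N j) (N (j + h)) (X j) (X (j + h)) ⟩
    2 * (X j + N j + N (j + h)) + X (j + h)  ≡⟨ cong (λ n → 2 * n + X (j + h)) (trans (cong (X j + N j +_) N[j+h]≡Mj) (around h≤d j)) ⟩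
    2 * k + X (j + h)                        ∎
    where
    open ≡-Reasoning
    h≤d : h ≤ d
    h≤d = subst (h ≤_) (sym d≡2h) (m≤m+n h h)
    N[j+h]≡Mj : N (j + h) ≡ M j
    N[j+h]≡Mj = cong (∑ X (suc j + h)) (sym (trans (cong (_∸ h) d≡2h) (m+n∸m≡n h h)))
    rearrange : ∀ a b c e → (2 * a + c) + (2 * b + e) + c ≡ 2 * (c + a + b) + e
    rearrange = solve-∀

  odd-pair : d ≡ suc (h + h) → ∀ j → v j + v (suc (j + h)) + X j + X (suc (j + h)) ≡ 2 * k
  odd-pair d≡2h+1 j = begin
    v j + v q + X j + X q                    ≡⟨ rearrange (N j) (N q) (X j) (X q) ⟩
    2 * (X j + N j + (X q + N q))            ≡⟨ cong (2 *_) (trans (cong (X j + N j +_) Xq+Nq≡Mj) (around h≤d j)) ⟩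
    2 * k                                    ∎
    where
    open ≡-Reasoning
    q : ℕ
    q = suc (j + h)
    h≤d : h ≤ d
    h≤d = subst (h ≤_) (sym d≡2h+1) (≤-trans (m≤m+n h h) (n≤1+n _))
    Xq+Nq≡Mj : X q + N q ≡ M j
    Xq+Nq≡Mj = cong (∑ X q) (sym (trans (cong (_∸ h) (trans d≡2h+1 (sym (+-suc h h)))) (m+n∸m≡n h (suc h))))
    rearrange : ∀ a b c e → (2 * a + c) + (2 * b + e) + c + e ≡ 2 * (c + a + (e + b))
    rearrange = solve-∀

  hits-even : d ≡ h + h → 0 < k → ∃ λ j → v j ≡ k
  hits-even d≡2h 0<k with ∑-pos x 0 m 0<k
  ... | w , xw≡true = periodic-hits v-periodic (proj₂ below) (proj₂ above) no-double-jump
    where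
    Xw≡1 : X w ≡ 1
    Xw≡1 = cong ⟦_⟧ xw≡true
    below : ∃ λ t → v t ≤ k
    below = some-≤ (≤-by-+ (even-pair d≡2h w) (subst (X (w + h) ≤_) (sym Xw≡1) (⟦⟧≤1 (x (w + h)))))
    above : ∃ λ t → k ≤ v t
    above with x (w + h) in xwh
    ... | true = some-≥ (m≤n⇒m≤1+n (≥-by-+ (even-pair d≡2h w) (subst (_≤ X (w + h)) (sym Xw≡1) (≤-reflexive (sym (cong ⟦_⟧ xwh))))))
    ... | false = some-≥ (m≤n⇒m≤1+n (≥-by-+ (even-pair d≡2h (w + h)) (subst (_≤ X (w + h + h)) (sym (cong ⟦_⟧ xwh)) z≤n)))

  hits-odd : d ≡ suc (h + h) → k < m → ∃ λ j → v j ≡ k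
  hits-odd d≡2h+1 k<m with ∑-<-length x 0 m k<m
  ... | z , xz≡false = periodic-hits v-periodic (proj₂ below) (proj₂ above) no-double-jump
    where
    q : ℕ
    q = suc (z + h)
    pair : v z + v q + X q ≡ 2 * k + 0
    pair = begin
      v z + v q + X q          ≡⟨ cong (_+ X q) (+-identityʳ (v z + v q)) ⟨
      v z + v q + 0 + X q      ≡⟨ cong (λ b → v z + v q + ⟦ b ⟧ + X q) xz≡false ⟨
      v z + v q + X z + X q    ≡⟨ odd-pair d≡2h+1 z ⟩
      2 * k                    ≡⟨ +-identityʳ (2 * k) ⟨
      2 * k + 0                ∎
      where open ≡-Reasoning
    below : ∃ λ t → v t ≤ k
    below = some-≤ (≤-by-+ pair z≤n)
    above : ∃ λ t → k ≤ v t
    above = some-≥ (≤-trans (≤-reflexive (sym (trans pair (+-identityʳ _))))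
                            (subst (v z + v q + X q ≤_) (+-comm _ 1) (+-monoʳ-≤ (v z + v q) (⟦⟧≤1 (x q)))))

  hit-within-period : (∃ λ j → v j ≡ k) → ∃ λ j → j < m × v j ≡ k
  hit-within-period (j , vj≡k) = j % m , m%n<n j m , trans (periodic-% v-periodic j) vj≡k

  balanced-rotation : (d ≡ h + h × 0 < k) ⊎ (d ≡ suc (h + h) × k < m) → ∃ λ j → j < m × v j ≡ k
  balanced-rotation (inj₁ (d≡2h , 0<k)) = hit-within-period (hits-even d≡2h 0<k)
  balanced-rotation (inj₂ (d≡2h+1 , k<m)) = hit-within-period (hits-odd d≡2h+1 k<m)

  balanced-windows : h ≤ d → ∀ {j} → v j ≡ k → N j ≡ M j
  balanced-windows h≤d {j} vj≡k = +-cancelˡ-≡ (N j) _ _ (+-cancelʳ-≡ (X j) _ _ (begin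
    N j + N j + X j      ≡⟨ cong (_+ X j) (2*-≡-+ (N j)) ⟨
    v j                  ≡⟨ vj≡k ⟩
    k                    ≡⟨ around h≤d j ⟨
    X j + N j + M j      ≡⟨ +-assoc (X j) (N j) (M j) ⟩
    X j + (N j + M j)    ≡⟨ +-comm (X j) (N j + M j) ⟩
    N j + M j + X j      ∎))
    where open ≡-Reasoning

  balanced-window-nonempty : 2 ≤ k → ∀ {j} → v j ≡ k → N j ≢ 0
  balanced-window-nonempty 2≤k {j} vj≡k Nj≡0 =
    <⇒≱ (s≤s (⟦⟧≤1 (x j))) (subst (2 ≤_) (trans (sym vj≡k) (cong (λ n → 2 * n + X j) Nj≡0)) 2≤k)

  plus-count : h ≤ d → ∀ j → count is+ x j ≡ N j
  plus-count h≤d j = begin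
    count is+ x j                ≡⟨ count-windows is+ x refl x-periodic h≤d j ⟩
    ∑ (λ i → ⟦ x i ∧ true ⟧) (suc j) h + ∑ (λ i → ⟦ x i ∧ false ⟧) (suc j + h) (d ∸ h)
                                 ≡⟨ cong₂ _+_ (∑-∧-true x (suc j) h) (∑-∧-false x (suc j + h) (d ∸ h)) ⟩
    N j + 0                      ≡⟨ +-identityʳ (N j) ⟩
    N j                          ∎
    where open ≡-Reasoning

  minus-count : h ≤ d → ∀ j → count is- x j ≡ M j
  minus-count h≤d j = begin
    count is- x j                ≡⟨ count-windows is- x refl x-periodic h≤d j ⟩
    ∑ (λ i → ⟦ x i ∧ false ⟧) (suc j) h + ∑ (λ i → ⟦ x i ∧ true ⟧) (suc j + h) (d ∸ h)
                                 ≡⟨ cong₂ _+_ (∑-∧-false x (suc j) h) (∑-∧-true x (suc j + h) (d ∸ h)) ⟩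
    M j                          ∎
    where open ≡-Reasoning

place : ∀ {n} → (ℕ → Maybe Sign) → Subset n → Bicoloring n
place c [] = []
place c (true ∷ A) = c 0 ∷ place (c ∘ suc) A
place c (false ∷ A) = nothing ∷ place c A

trace : ∀ {n} → Subset n → Subset n → ℕ → Bool
trace [] [] r = false
trace (true ∷ A) (b ∷ B) zero = b
trace (true ∷ A) (b ∷ B) (suc r) = trace A B r
trace (false ∷ A) (b ∷ B) r = trace A B r

∣∩∣-trace : ∀ {n} (A B : Subset n) → ∣ B ∩ A ∣ ≡ ∑ (λ r → ⟦ trace A B r ⟧) 0 ∣ A ∣
∣∩∣-trace [] [] = refl
∣∩∣-trace (false ∷ A) (b ∷ B) with b
... | true = ∣∩∣-trace A B
... | false = ∣∩∣-trace A B
∣∩∣-trace (true ∷ A) (true ∷ B) = trans (cong suc (∣∩∣-trace A B)) (sym (∑-from-0 (λ r → ⟦ trace (true ∷ A) (true ∷ B) r ⟧) ∣ A ∣))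
∣∩∣-trace (true ∷ A) (false ∷ B) = trans (∣∩∣-trace A B) (sym (∑-from-0 (λ r → ⟦ trace (true ∷ A) (false ∷ B) r ⟧) ∣ A ∣))

∣∩class∣-place : ∀ {n} (P : Maybe Sign → Bool) → P nothing ≡ false → (c : ℕ → Maybe Sign) (A B : Subset n) →
                  ∣ B ∩ map P (place c A) ∣ ≡ ∑ (λ r → ⟦ trace A B r ∧ P (c r) ⟧) 0 ∣ A ∣
∣∩class∣-place P P-nothing c [] [] = refl
∣∩class∣-place P P-nothing c (false ∷ A) (b ∷ B) rewrite P-nothing with b
... | true = ∣∩class∣-place P P-nothing c A B
... | false = ∣∩class∣-place P P-nothing c A B
∣∩class∣-place P P-nothing c (true ∷ A) (b ∷ B) =
  trans (head (b ∧ P (c 0))) (sym (∑-from-0 (λ r → ⟦ trace (true ∷ A) (b ∷ B) r ∧ P (c r) ⟧) ∣ A ∣))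
  where
  head : ∀ b′ → ∣ b′ ∷ (B ∩ map P (place (c ∘ suc) A)) ∣ ≡ ⟦ b′ ⟧ + ∑ (λ r → ⟦ trace A B r ∧ P (c (suc r)) ⟧) 0 ∣ A ∣
  head true = cong suc (∣∩class∣-place P P-nothing (c ∘ suc) A B)
  head false = ∣∩class∣-place P P-nothing (c ∘ suc) A B

∣class∣-place : ∀ {n} (P : Maybe Sign → Bool) → P nothing ≡ false → (c : ℕ → Maybe Sign) (A : Subset n) →
                ∣ map P (place c A) ∣ ≡ ∑ (λ r → ⟦ P (c r) ⟧) 0 ∣ A ∣
∣class∣-place P P-nothing c [] = refl
∣class∣-place P P-nothing c (false ∷ A) rewrite P-nothing = ∣class∣-place P P-nothing c A
∣class∣-place P P-nothing c (true ∷ A) = trans (head (P (c 0))) (sym (∑-from-0 (λ r → ⟦ P (c r) ⟧) ∣ A ∣))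
  where
  head : ∀ b → ∣ b ∷ map P (place (c ∘ suc) A) ∣ ≡ ⟦ b ⟧ + ∑ (λ r → ⟦ P (c (suc r)) ⟧) 0 ∣ A ∣
  head true = cong suc (∣class∣-place P P-nothing (c ∘ suc) A)
  head false = ∣class∣-place P P-nothing (c ∘ suc) A

plusSet≗ : ∀ {n} (X : Bicoloring n) → plusSet X ≡ map is+ X
plusSet≗ = map-cong λ { nothing → refl ; (just +ˢ) → refl ; (just -ˢ) → refl }

minusSet≗ : ∀ {n} (X : Bicoloring n) → minusSet X ≡ map is- X
minusSet≗ = map-cong λ { nothing → refl ; (just +ˢ) → refl ; (just -ˢ) → refl }

domain≗ : ∀ {n} (X : Bicoloring n) → domain X ≡ map is-coloured X
domain≗ = map-cong λ { nothing → refl ; (just _) → refl }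

parity-split : ∀ d → (Even d × d ≡ d / 2 + d / 2) ⊎ (Odd d × d ≡ suc (d / 2 + d / 2))
parity-split d = by-remainder (d % 2) refl (m%n<n d 2)
  where
  halves : ∀ {r} → d % 2 ≡ r → d ≡ r + d / 2 * 2
  halves d%2≡r = trans (m≡m%n+[m/n]*n d 2) (cong (_+ d / 2 * 2) d%2≡r)
  even-halves : ∀ h → 0 + h * 2 ≡ h + h
  even-halves = solve-∀
  odd-halves : ∀ h → 1 + h * 2 ≡ suc (h + h)
  odd-halves = solve-∀
  by-remainder : ∀ r → d % 2 ≡ r → r < 2 → (Even d × d ≡ d / 2 + d / 2) ⊎ (Odd d × d ≡ suc (d / 2 + d / 2))
  by-remainder 0 d%2≡0 _ = inj₁ (d%2≡0 , trans (halves d%2≡0) (even-halves (d / 2)))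
  by-remainder 1 d%2≡1 _ = inj₂ (d%2≡1 , trans (halves d%2≡1) (odd-halves (d / 2)))
  by-remainder (suc (suc _)) _ (s≤s (s≤s ()))

rotations : ∀ {n} → ℕ → Subset n → List (Bicoloring n)
rotations d A = List.map (λ j → place (Rotation.colour d (d / 2) j) A) (upTo (suc d))

length-rotations : ∀ {n} d (A : Subset n) → length (rotations d A) ≡ d + 1
length-rotations d A = trans (length-map _ (upTo (suc d))) (trans (length-upTo (suc d)) (+-comm 1 d))

length-concatMap : ∀ {A B : Set} {c} (f : A → List B) → (∀ a → length (f a) ≡ c) → ∀ as → length (concatMap f as) ≡ length as * c
length-concatMap f |f|≡c [] = refl
length-concatMap f |f|≡c (a ∷ as) = trans (length-++ (f a)) (cong₂ _+_ (|f|≡c a) (length-concatMap f |f|≡c as))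

rotations-size : ∀ {n} d (A : Subset n) → ∣ A ∣ ≡ d + 1 → All (λ X → ∣ domain X ∣ ≡ d) (rotations d A)
rotations-size d A |A|≡d+1 = All.map⁺ (All.tabulate λ {j} _ → begin
  ∣ domain (place (colour j) A) ∣                       ≡⟨ cong ∣_∣ (domain≗ (place (colour j) A)) ⟩
  ∣ map is-coloured (place (colour j) A) ∣              ≡⟨ ∣class∣-place is-coloured refl (colour j) A ⟩
  ∑ (λ r → ⟦ is-coloured (colour j r) ⟧) 0 ∣ A ∣        ≡⟨ cong (∑ _ 0) (trans |A|≡d+1 (+-comm d 1)) ⟩
  count is-coloured (λ _ → true) j                      ≡⟨ coloured-count (m/n≤m d 2) j ⟩
  d                                                     ∎)
  where
  open ≡-Reasoning
  open Rotation d (d / 2)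

module Traced {n} (d : ℕ) (A B : Subset n) (|A|≡d+1 : ∣ A ∣ ≡ d + 1) where

  open Windows d (d / 2) (trace A B) public

  |A|≡m : ∣ A ∣ ≡ m
  |A|≡m = trans |A|≡d+1 (+-comm d 1)

  trace≗x : ∀ {r} → 0 ≤ r → r < 0 + m → trace A B r ≡ x r
  trace≗x _ r<m = cong (trace A B) (sym (m<n⇒m%n≡m r<m))

  |B∩A|≡k : ∣ B ∩ A ∣ ≡ k
  |B∩A|≡k = trans (∣∩∣-trace A B) (trans (cong (∑ _ 0) |A|≡m) (∑-cong 0 m λ r≥0 r<m → cong ⟦_⟧ (trace≗x r≥0 r<m)))

  ∣B∩class∣ : ∀ P → P nothing ≡ false → ∀ j → ∣ B ∩ map P (place (colour j) A) ∣ ≡ count P x j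
  ∣B∩class∣ P P-nothing j = trans (∣∩class∣-place P P-nothing (colour j) A B)
    (trans (cong (∑ _ 0) |A|≡m) (∑-cong 0 m λ {r} r≥0 r<m → cong (λ b → ⟦ b ∧ P (colour j r) ⟧) (trace≗x r≥0 r<m)))

  ∣B∩plusSet∣ : ∀ j → ∣ B ∩ plusSet (place (colour j) A) ∣ ≡ N j
  ∣B∩plusSet∣ j = trans (cong (λ S → ∣ B ∩ S ∣) (plusSet≗ _)) (trans (∣B∩class∣ is+ refl j) (plus-count (m/n≤m d 2) j))

  ∣B∩minusSet∣ : ∀ j → ∣ B ∩ minusSet (place (colour j) A) ∣ ≡ M j
  ∣B∩minusSet∣ j = trans (cong (λ S → ∣ B ∩ S ∣) (minusSet≗ _)) (trans (∣B∩class∣ is- refl j) (minus-count (m/n≤m d 2) j))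

rotations-bisect : ∀ {n} d (A B : Subset n) → ∣ A ∣ ≡ d + 1 → Covers d B A →
                   Any (λ X → InducedBisects X B) (rotations d A)
rotations-bisect d A B |A|≡d+1 cover = rotation-bisects (balanced-rotation (proj₂ bounds))
  where
  open Traced d A B |A|≡d+1
  bounds : 2 ≤ k × ((d ≡ d / 2 + d / 2 × 0 < k) ⊎ (d ≡ suc (d / 2 + d / 2) × k < m))
  bounds with parity-split d
  ... | inj₁ (even , d≡2h) = 2≤k , inj₁ (d≡2h , ≤-trans (s≤s z≤n) 2≤k)
    where
    2≤k : 2 ≤ k
    2≤k = subst (2 ≤_) |B∩A|≡k (proj₁ cover even)
  ... | inj₂ (odd , d≡2h+1) = subst (2 ≤_) |B∩A|≡k (proj₁ (proj₂ cover odd)) ,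
                              inj₂ (d≡2h+1 , s≤s (subst (_≤ d) |B∩A|≡k (proj₂ (proj₂ cover odd))))
  rotation-bisects : (∃ λ j → j < m × v j ≡ k) → Any (λ X → InducedBisects X B) (rotations d A)
  rotation-bisects (j , j<m , vj≡k) = lose (∈-map⁺ (λ j → place (colour j) A) (∈-upTo⁺ j<m)) (equal , nonzero)
    where
    colouring : Bicoloring _
    colouring = place (colour j) A
    equal : ∣ B ∩ plusSet colouring ∣ ≡ ∣ B ∩ minusSet colouring ∣
    equal = trans (∣B∩plusSet∣ j) (trans (balanced-windows (m/n≤m d 2) vj≡k) (sym (∣B∩minusSet∣ j)))
    nonzero : ∣ B ∩ plusSet colouring ∣ ≢ 0
    nonzero = λ B∩X⁺≡0 → balanced-window-nonempty (proj₁ bounds) vj≡k (trans (sym (∣B∩plusSet∣ j)) B∩X⁺≡0)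

corollary1 : (n : ℕ) (H : Hypergraph n) (d : ℕ) → 2 ≤ d → d ≤ n →
    (F : List (Subset n)) → Unique F → All (λ A → ∣ A ∣ ≡ d + 1) F →
    (∀ B → B ∈ edges H → Σ (Subset n) (λ A → A ∈ F × Covers d B A)) →
    Σ (List (Bicoloring n)) (λ fam →
      IsInducedBisectingFamily d H fam × length fam ≡ length F * (d + 1))
corollary1 n H d _ _ F _ sizes covers =
  concatMap (rotations d) F , (orders , bisected) , length-concatMap (rotations d) (length-rotations d) F
  where
  orders : All (λ X → ∣ domain X ∣ ≡ d) (concatMap (rotations d) F)
  orders = All.concat⁺ (All.map⁺ (All.map (λ {A} → rotations-size d A) sizes))
  bisected : ∀ B → B ∈ edges H → ¬ Trivial d B → Any (λ X → InducedBisects X B) (concatMap (rotations d) F)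
  bisected B B∈H _ with covers B B∈H
  ... | A , A∈F , cover = Any.concatMap⁺ (rotations d) (lose A∈F (rotations-bisect d A B (All.lookup sizes A∈F) cover))
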